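{- Let $1\le \ell<n/2$, and consider a room of $n$ people (knights and spies, at most $\ell$ spies) in which a questioner carries out Step 1 of the Spider Interrogation Strategy, with the spies answering arbitrarily. Let $P$ be the path representing the questions asked in Step 1 (defined in the context). Then there is a bijective correspondence between the visits of $P$ to $0$ from above and the knights rejected as candidates in Step 1.
   Context: Setting: each person is a knight or a spy; knights always answer truthfully, spies arbitrarily. Questions "Person $i$, what is the identity of person $j$?" are answered "knight" (support) or "spy" (accusation). Step 1 of the Spider Interrogation Strategy: keep a threshold $L$, initially $\ell$; choose an uninvolved person as candidate and repeatedly ask new uninvolved people about him until either (a) strictly more have accused than supported him, or (b) $L$ people have supported him. In case (a), with $a$ accusers, reject him, set aside the $2a$ people involved, replace $L$ by $L-a$, and repeat with a new candidate; in case (b) accept him. Path: a path is a sequence of steps $\pm 1$ starting at height $0$. The path $P$ has one step for each of the following events, in order: whenever a new candidate is chosen, an initial step which is up if the candidate is a knight and down if he is a spy; for each question, a step up if a knight is supported or a spy is accused, and down if a knight is accused or a spy is supported. After a candidate is accepted, one imagines continuing to ask new people about the accepted candidate until everyone in the room has been a candidate or been asked a question, adding steps by the same rule, so that $P$ has exactly $n$ steps. A path visits $m$ from above at time $r$ if its height after $r$ steps is $m$ and its $r$-th step is downward. -}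

module Defs where

open import Data.Bool using (Bool; true; false; if_then_else_; not; _xor_)
open import Data.Nat using (ℕ; zero; suc; _+_; _∸_; _<ᵇ_; _≤ᵇ_)
open import Data.Integer using (ℤ; +_; -[1+_]) renaming (_+_ to _+ℤ_)
open import Data.Nat.ListAction using (sum)
open import Data.List using (List; []; _∷_; map; allFin; take; length; lookup)
open import Data.Fin using (Fin; toℕ)
open import Data.Fin.Permutation using (Permutation′; _⟨$⟩ʳ_)
open import Data.Product using (_×_; _,_; proj₁; proj₂)
open import Relation.Binary.PropositionalEquality using (_≡_)

-- Identities: a function  knight : Fin n → Bool ,  true = knight, false = spy.

numSpies : ∀ {n} → (Fin n → Bool) → ℕ
numSpies {n} knight = sum (map (λ i → if knight i then 0 else 1) (allFin n))

-- The order in which people become involved (as candidate or as the person asked),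
-- given by a permutation of the room.
involvementOrder : ∀ {n} → Permutation′ n → List (Fin n)
involvementOrder {n} π = map (π ⟨$⟩ʳ_) (allFin n)

-- A path is a list of steps: true = up (+1), false = down (-1).
stepValue : Bool → ℤ
stepValue true  = + 1
stepValue false = -[1+ 0 ]

height : List Bool → ℤ
height []       = + 0
height (s ∷ ss) = stepValue s +ℤ height ss

heightAfter : List Bool → ℕ → ℤ
heightAfter P r = height (take r P)

-- P visits 0 from above at time r = suc (toℕ i): height after r steps is 0
-- and the r-th step (index i) is downward.
VisitsZeroFromAbove : (P : List Bool) → Fin (length P) → Set
VisitsZeroFromAbove P i = (heightAfter P (suc (toℕ i)) ≡ + 0) × (lookup P i ≡ false)

-- Step 1 of the Spider Interrogation Strategy, run on a given order of involvement.
--   knight : identities (true = knight);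
--   ans    : the answer ("knight" = true) a person gives when asked; only used
--            when that person is a spy (each person is asked at most once, so
--            this is fully general); knights answer truthfully.
module Step1 {n : ℕ} (knight : Fin n → Bool) (ans : Fin n → Bool) where

  answer : Fin n → Fin n → Bool
  answer p c = if knight p then knight c else ans p

  -- step for the question "p, what is c?": up iff a knight is supported or a
  -- spy is accused, i.e. iff the answer is the truth.
  qStep : Fin n → Fin n → Bool
  qStep p c = not (answer p c xor knight c)

  -- imagined continuation after acceptance of c: ask everybody remaining about c
  continue : Fin n → List (Fin n) → List Bool
  continue c []       = []
  continue c (p ∷ ps) = qStep p c ∷ continue c ps

  consStep : Bool → List Bool × List (Fin n) → List Bool × List (Fin n)
  consStep s (ss , r) = (s ∷ ss , r)

  consRej : Fin n → List Bool × List (Fin n) → List Bool × List (Fin n)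
  consRej c (ss , r) = (ss , c ∷ r)

  -- Result: (steps of the path P, list of rejected candidates in order).
  mutual
    newRound : ℕ → List (Fin n) → List Bool × List (Fin n)
    newRound L []         = ([] , [])
    newRound L (c ∷ rest) = consStep (knight c) (questions L c 0 0 rest)

    questions : ℕ → Fin n → ℕ → ℕ → List (Fin n) → List Bool × List (Fin n)
    questions L c acc sup ps = checkA L c acc sup ps (sup <ᵇ acc)

    checkA : ℕ → Fin n → ℕ → ℕ → List (Fin n) → Bool → List Bool × List (Fin n)
    checkA L c acc sup ps true  = consRej c (newRound (L ∸ acc) ps)
    checkA L c acc sup ps false = checkB L c acc sup ps (L ≤ᵇ sup)

    checkB : ℕ → Fin n → ℕ → ℕ → List (Fin n) → Bool → List Bool × List (Fin n)
    checkB L c acc sup ps true         = (continue c ps , [])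
    checkB L c acc sup [] false        = ([] , [])
    checkB L c acc sup (p ∷ ps) false  =
      consStep (qStep p c)
        (questions L c (acc + (if answer p c then 0 else 1))
                       (sup + (if answer p c then 1 else 0)) ps)

  path : ℕ → List (Fin n) → List Bool
  path ℓ order = proj₁ (newRound ℓ order)

  rejected : ℕ → List (Fin n) → List (Fin n)
  rejected ℓ order = proj₂ (newRound ℓ order)

module Submission where

-- Both sides are finite sets of proofs, so it suffices to count them.
--
-- Within the
-- round of a knight candidate the path stays at height 1 + sup - acc ≥ 1 and
-- comes down to 0 exactly when he is rejected; in the round of a spy candidate
-- it stays at sup - acc - 1 ≤ -1, and his rejection is an upward step to 0.
-- A spy candidate can never reach L supporters, and an accepted knight is never
-- brought back to 0 by the imagined continuation, because only spies move the
-- path in the unfavourable direction and a budget argument (at most L spies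
-- remain, L decreasing by a per rejection while at least a spies are set aside)
-- bounds their number.  Hence, round by round, visits and rejected knights
-- agree; the theorem follows once the number of spies is seen to be
-- independent of the order in which people are involved.

open import Defs
open import Data.Bool using (Bool; true; false; if_then_else_; not; _xor_; T)
open import Data.Bool.Properties using (not-distribʳ-xor; xor-identityʳ)
open import Data.Nat using (ℕ; zero; suc; _≤_; _<_; _*_; _+_; _∸_; _<ᵇ_; _≤ᵇ_; s≤s)
open import Data.Nat.Properties
  using (+-identityʳ; +-assoc; +-monoʳ-≤; +-cancelˡ-≤; +-comm; +-suc; ≤-trans; ≤-reflexive; m≤n+m; m≤m+n;
         <⇒<ᵇ; <ᵇ⇒<; <⇒≱; ≤ᵇ⇒≤; m+n≤o⇒m≤o∸n; +-0-commutativeMonoid; n≮n)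
open import Data.Nat.ListAction using (sum)
open import Data.Integer using (ℤ; +_; -[1+_]) renaming (_+_ to _+ℤ_)
import Data.Integer.Properties as ℤ
open import Data.Fin using (Fin; toℕ) renaming (zero to fzero; suc to fsuc)
open import Data.Fin.Properties using (+↔⊎)
open import Data.Fin.Permutation using (Permutation′; _⟨$⟩ʳ_)
open import Data.List using (List; []; _∷_; length; map; tabulate; allFin; lookup)
open import Data.List.Properties using (map-tabulate)
open import Data.List.Membership.Propositional using (_∈_)
open import Data.List.Membership.Propositional.Properties using (Any↔)
open import Data.List.Relation.Unary.Any using (Any)
open import Data.List.Relation.Unary.Any.Properties using (∷↔)
open import Data.Product using (Σ; _×_; _,_; proj₁; proj₂)
open import Data.Product.Function.Dependent.Propositional using (Σ-↔)
open import Data.Sum using (_⊎_; inj₁; inj₂)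
open import Data.Sum.Function.Propositional using (_⊎-↔_)
open import Data.Unit using (tt)
open import Data.Empty using (⊥-elim)
open import Function using (_∘_)
open import Function.Bundles using (_↔_; mk↔ₛ′)
open import Function.Properties.Inverse using (↔-refl; ↔-sym)
open import Function.Related.Propositional using (K-reflexive; module EquationalReasoning)
open import Relation.Binary.PropositionalEquality
  using (_≡_; refl; sym; trans; cong; subst; module ≡-Reasoning)
import Algebra.Properties.CommutativeMonoid.Sum as MonoidSum

Σ-Fin-suc : ∀ {m} (F : Fin (suc m) → Set) → Σ (Fin (suc m)) F ↔ (F fzero ⊎ Σ (Fin m) (F ∘ fsuc))
Σ-Fin-suc F = mk↔ₛ′ split join (λ { (inj₁ _) → refl ; (inj₂ _) → refl })
                               (λ { (fzero , _) → refl ; (fsuc _ , _) → refl })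
  where
  split : Σ _ F → F fzero ⊎ Σ _ (F ∘ fsuc)
  split (fzero  , x) = inj₁ x
  split (fsuc i , x) = inj₂ (i , x)
  join : F fzero ⊎ Σ _ (F ∘ fsuc) → Σ _ F
  join (inj₁ x)       = fzero , x
  join (inj₂ (i , x)) = fsuc i , x

Σ-Fin-zero : (F : Fin 0 → Set) → Σ (Fin 0) F ↔ Fin 0
Σ-Fin-zero F = mk↔ₛ′ (λ { (() , _) }) (λ ()) (λ ()) (λ { (() , _) })

Fin-⊎ : ∀ {a b} → (Fin a ⊎ Fin b) ↔ Fin (a + b)
Fin-⊎ {a} {b} = ↔-sym (+↔⊎ {a} {b})

arrivalVisit : Bool → ℤ → ℕ
arrivalVisit false (+ zero) = 1
arrivalVisit _     _        = 0

visits : ℤ → List Bool → ℕ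
visits h []       = 0
visits h (s ∷ ss) = arrivalVisit s (stepValue s +ℤ h) + visits (stepValue s +ℤ h) ss

Visit : ℤ → (P : List Bool) → Fin (length P) → Set
Visit h P i = (h +ℤ heightAfter P (suc (toℕ i)) ≡ + 0) × (lookup P i ≡ false)

arrival↔ : ∀ s x → ((x ≡ + 0) × (s ≡ false)) ↔ Fin (arrivalVisit s x)
arrival↔ true     x          = mk↔ₛ′ (λ { (_ , ()) }) (λ ()) (λ ()) (λ { (_ , ()) })
arrival↔ false    (+ zero)   = mk↔ₛ′ (λ _ → fzero) (λ _ → refl , refl)
                                      (λ { fzero → refl ; (fsuc ()) }) (λ { (refl , refl) → refl })
arrival↔ false    (+ suc _)  = mk↔ₛ′ (λ { (() , _) }) (λ ()) (λ ()) (λ { (() , _) })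
arrival↔ false    -[1+ _ ]   = mk↔ₛ′ (λ { (() , _) }) (λ ()) (λ ()) (λ { (() , _) })

offset-shift : ∀ h v x → h +ℤ (v +ℤ x) ≡ (v +ℤ h) +ℤ x
offset-shift h v x = trans (sym (ℤ.+-assoc h v x)) (cong (_+ℤ x) (ℤ.+-comm h v))

visits↔ : ∀ h P → Σ (Fin (length P)) (Visit h P) ↔ Fin (visits h P)
visits↔ h [] = Σ-Fin-zero _
visits↔ h (s ∷ ss) =
  begin
    Σ (Fin (suc (length ss))) (Visit h (s ∷ ss))
  ↔⟨ Σ-Fin-suc _ ⟩
    (Visit h (s ∷ ss) fzero ⊎ Σ (Fin (length ss)) (Visit h (s ∷ ss) ∘ fsuc))
  ↔⟨ first ⊎-↔ Σ-↔ ↔-refl rest ⟩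
    (Fin (arrivalVisit s h′) ⊎ Σ (Fin (length ss)) (Visit h′ ss))
  ↔⟨ ↔-refl ⊎-↔ visits↔ h′ ss ⟩
    (Fin (arrivalVisit s h′) ⊎ Fin (visits h′ ss))
  ↔⟨ Fin-⊎ ⟩
    Fin (visits h (s ∷ ss))
  ∎
  where
  open EquationalReasoning
  h′ : ℤ
  h′ = stepValue s +ℤ h
  first : Visit h (s ∷ ss) fzero ↔ Fin (arrivalVisit s h′)
  first = begin
      Visit h (s ∷ ss) fzero
    ↔⟨ K-reflexive (cong (λ y → (y ≡ + 0) × (s ≡ false))
                         (trans (offset-shift h (stepValue s) (+ 0)) (ℤ.+-identityʳ h′))) ⟩
      ((h′ ≡ + 0) × (s ≡ false))
    ↔⟨ arrival↔ s h′ ⟩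
      Fin (arrivalVisit s h′)
    ∎
  rest : ∀ {i} → Visit h (s ∷ ss) (fsuc i) ↔ Visit h′ ss i
  rest {i} = K-reflexive (cong (λ y → (y ≡ + 0) × (lookup ss i ≡ false))
                                (offset-shift h (stepValue s) (heightAfter ss (suc (toℕ i)))))

visitsZeroFromAbove↔ : ∀ P → Σ (Fin (length P)) (VisitsZeroFromAbove P) ↔ Fin (visits (+ 0) P)
visitsZeroFromAbove↔ P =
  begin
    Σ (Fin (length P)) (VisitsZeroFromAbove P)
  ↔⟨ Σ-↔ ↔-refl (λ {i} → K-reflexive (cong (λ y → (y ≡ + 0) × (lookup P i ≡ false))
                                            (sym (ℤ.+-identityˡ _)))) ⟩
    Σ (Fin (length P)) (Visit (+ 0) P)
  ↔⟨ visits↔ (+ 0) P ⟩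
    Fin (visits (+ 0) P)
  ∎
  where open EquationalReasoning

count : ∀ {A : Set} → (A → Bool) → List A → ℕ
count f []       = 0
count f (x ∷ xs) = (if f x then 1 else 0) + count f xs

bool↔ : ∀ b → (b ≡ true) ↔ Fin (if b then 1 else 0)
bool↔ true  = mk↔ₛ′ (λ _ → fzero) (λ _ → refl) (λ { fzero → refl ; (fsuc ()) }) (λ { refl → refl })
bool↔ false = mk↔ₛ′ (λ ()) (λ ()) (λ ()) (λ ())

any↔count : ∀ {A : Set} (f : A → Bool) xs → Any (λ x → f x ≡ true) xs ↔ Fin (count f xs)
any↔count f [] = mk↔ₛ′ (λ ()) (λ ()) (λ ()) (λ ())
any↔count f (x ∷ xs) =
  begin
    Any (λ y → f y ≡ true) (x ∷ xs)
  ↔⟨ ↔-sym (∷↔ _) ⟩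
    ((f x ≡ true) ⊎ Any (λ y → f y ≡ true) xs)
  ↔⟨ bool↔ (f x) ⊎-↔ any↔count f xs ⟩
    (Fin (if f x then 1 else 0) ⊎ Fin (count f xs))
  ↔⟨ Fin-⊎ ⟩
    Fin (count f (x ∷ xs))
  ∎
  where open EquationalReasoning

members↔count : ∀ {A : Set} (f : A → Bool) xs → Σ A (λ x → (x ∈ xs) × (f x ≡ true)) ↔ Fin (count f xs)
members↔count f xs =
  begin
    Σ _ (λ x → (x ∈ xs) × (f x ≡ true))
  ↔⟨ Any↔ ⟩
    Any (λ x → f x ≡ true) xs
  ↔⟨ any↔count f xs ⟩
    Fin (count f xs)
  ∎
  where open EquationalReasoning

-- A sum over the room does not depend on the order in which the room is
-- listed; the library provides this for sums over vectors.

module _ where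
  open MonoidSum +-0-commutativeMonoid using () renaming (sum to ∑; sum-permute to ∑-permute)

  sum-tabulate : ∀ {m} (g : Fin m → ℕ) → sum (tabulate g) ≡ ∑ g
  sum-tabulate {zero}  g = refl
  sum-tabulate {suc m} g = cong (λ t → g fzero + t) (sum-tabulate (g ∘ fsuc))

  sum-reorder : ∀ {n} (f : Fin n → ℕ) (π : Permutation′ n) →
    sum (map f (involvementOrder π)) ≡ sum (map f (allFin n))
  sum-reorder {n} f π =
    begin
      sum (map f (map (π ⟨$⟩ʳ_) (tabulate (λ i → i))))
    ≡⟨ cong (sum ∘ map f) (map-tabulate (λ i → i) (π ⟨$⟩ʳ_)) ⟩
      sum (map f (tabulate (π ⟨$⟩ʳ_)))
    ≡⟨ cong sum (map-tabulate (π ⟨$⟩ʳ_) f) ⟩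
      sum (tabulate (f ∘ (π ⟨$⟩ʳ_)))
    ≡⟨ sum-tabulate (f ∘ (π ⟨$⟩ʳ_)) ⟩
      ∑ (f ∘ (π ⟨$⟩ʳ_))
    ≡⟨ sym (∑-permute f π) ⟩
      ∑ f
    ≡⟨ sym (sum-tabulate f) ⟩
      sum (tabulate f)
    ≡⟨ cong sum (sym (map-tabulate (λ i → i) f)) ⟩
      sum (map f (allFin n))
    ∎
    where open ≡-Reasoning

-- Arithmetic bookkeeping for the counters acc and sup: a support raises the
-- difference sup - acc by one, an accusation lowers it by one, and an
-- accusation at difference 0 tips the balance towards rejection.

support-balance : ∀ {a k s} → a + k ≡ s → a + 0 + suc k ≡ s + 1
support-balance {a} {k} refl = trans (cong (_+ suc k) (+-identityʳ a))
                                (trans (+-suc a k) (sym (+-comm (a + k) 1)))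

accuse-balance : ∀ {a k s} → a + suc k ≡ s → a + 1 + k ≡ s + 0
accuse-balance {a} {k} refl = trans (+-assoc a 1 k) (sym (+-identityʳ (a + suc k)))

accuse-tips : ∀ {a s} → a + 0 ≡ s → suc s ≡ a + 1
accuse-tips {a} refl = sym (+-suc a 0)

accuse-rejects : ∀ {a s} → a + 0 ≡ s → s + 0 < a + 1
accuse-rejects {s = s} e = ≤-reflexive (trans (cong suc (+-identityʳ s)) (accuse-tips e))

remaining-budget : ∀ {a s L} → a + s ≤ L → s ≤ L ∸ a
remaining-budget {a} {s} {L} le = m+n≤o⇒m≤o∸n s (subst (_≤ L) (+-comm a s) le)

≤ᵇ-sound : ∀ {m n} → (m ≤ᵇ n) ≡ true → m ≤ n
≤ᵇ-sound {m} {n} e = ≤ᵇ⇒≤ m n (subst T (sym e) tt)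

module Step1Analysis {n : ℕ} (knight : Fin n → Bool) (ans : Fin n → Bool) where
  open Step1 knight ans

  spy : Fin n → ℕ
  spy p = if knight p then 0 else 1

  spies : List (Fin n) → ℕ
  spies ps = sum (map spy ps)

  spies-∷ : ∀ p ps → spies ps ≤ spies (p ∷ ps)
  spies-∷ p ps = m≤n+m (spies ps) (spy p)

  spies-∷-spy : ∀ {p} ps → knight p ≡ false → spies (p ∷ ps) ≡ suc (spies ps)
  spies-∷-spy ps kp = cong (λ b → (if b then 0 else 1) + spies ps) kp

  -- Whoever accuses a knight, or supports a spy, is a spy: when p is a knight,
  -- with-abstraction turns  said  into a statement about  knight c  that
  -- contradicts  kc .
  accuser-of-knight : ∀ {p c} → knight c ≡ true → answer p c ≡ false → knight p ≡ false
  accuser-of-knight {p} kc said with knight p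
  ... | true  = trans (sym kc) said
  ... | false = refl

  supporter-of-spy : ∀ {p c} → knight c ≡ false → answer p c ≡ true → knight p ≡ false
  supporter-of-spy {p} kc said with knight p
  ... | true  = trans (sym said) kc
  ... | false = refl

  qStep-knight : ∀ {p c} → knight c ≡ true → qStep p c ≡ answer p c
  qStep-knight {p} {c} kc = begin
      qStep p c                 ≡⟨ cong (λ t → not (answer p c xor t)) kc ⟩
      not (answer p c xor true) ≡⟨ not-distribʳ-xor (answer p c) true ⟩
      answer p c xor false      ≡⟨ xor-identityʳ (answer p c) ⟩
      answer p c                ∎
    where open ≡-Reasoning

  qStep-spy : ∀ {p c} → knight c ≡ false → qStep p c ≡ not (answer p c)
  qStep-spy {p} {c} kc = begin
      qStep p c                  ≡⟨ cong (λ t → not (answer p c xor t)) kc ⟩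
      not (answer p c xor false) ≡⟨ cong not (xor-identityʳ (answer p c)) ⟩
      not (answer p c)           ∎
    where open ≡-Reasoning

  questions-reject : ∀ {L c acc sup ps} → sup < acc →
    questions L c acc sup ps ≡ consRej c (newRound (L ∸ acc) ps)
  questions-reject {acc = acc} {sup = sup} lt with sup <ᵇ acc | <⇒<ᵇ lt
  ... | true | _ = refl

  questions-continue : ∀ {L c acc sup ps} → acc ≤ sup →
    questions L c acc sup ps ≡ checkB L c acc sup ps (L ≤ᵇ sup)
  questions-continue {acc = acc} {sup = sup} le with sup <ᵇ acc in rejecting
  ... | false = refl
  ... | true  = ⊥-elim (<⇒≱ (<ᵇ⇒< sup acc (subst T (sym rejecting) tt)) le)

  Balanced : ℤ → List Bool × List (Fin n) → Set
  Balanced h q = visits h (proj₁ q) ≡ count knight (proj₂ q)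

  -- After a knight is accepted at height k+1, only spies can push the
  -- imagined continuation down; with at most k of them left it never returns to 0.
  continuation-stays-above : ∀ {c} → knight c ≡ true → ∀ k ps → spies ps ≤ k →
    visits (+ suc k) (continue c ps) ≡ 0
  continuation-stays-above kc k [] _ = refl
  continuation-stays-above {c} kc k (p ∷ ps) budget rewrite qStep-knight {p} kc with answer p c in said
  ... | true  = continuation-stays-above kc (suc k) ps (≤-trans (≤-trans (spies-∷ p ps) budget) (m≤n+m k 1))
  ... | false with k | subst (_≤ k) (spies-∷-spy ps (accuser-of-knight kc said)) budget
  ...   | suc k′ | s≤s budget′ = continuation-stays-above kc k′ ps budget′

  -- For a
  -- knight candidate the path stands at height k + 1 with acc + k = sup; for
  -- a spy candidate at -(j + 1) with acc + j = sup.  The budget bounds the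
  -- spies still to be met plus those already known in the round (accusers of
  -- a knight; a spy candidate and his supporters) by the threshold L.  In
  -- roundStart the with-abstraction on  knight c  also specialises  budget .
  mutual
    roundStart : ∀ L ps → spies ps ≤ L → Balanced (+ 0) (newRound L ps)
    roundStart L []         _      = refl
    roundStart L (c ∷ rest) budget with knight c in kc
    ... | true  = knightRound L c kc 0 0 0 rest refl budget
    ... | false = spyRound L c kc 0 0 0 rest refl budget

    knightRound : ∀ L c → knight c ≡ true → ∀ acc sup k ps →
      acc + k ≡ sup → acc + spies ps ≤ L → Balanced (+ suc k) (questions L c acc sup ps)
    knightRound L c kc acc sup k ps balance budget
      rewrite questions-continue {L} {c} {acc} {sup} {ps} (subst (acc ≤_) balance (m≤m+n acc k))
      with L ≤ᵇ sup in accepted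
    ... | true  = continuation-stays-above kc k ps
                    (+-cancelˡ-≤ acc _ _ (≤-trans budget (≤-trans (≤ᵇ-sound accepted) (≤-reflexive (sym balance)))))
    ... | false = knightAsks L c kc acc sup k ps balance budget

    knightAsks : ∀ L c → knight c ≡ true → ∀ acc sup k ps →
      acc + k ≡ sup → acc + spies ps ≤ L → Balanced (+ suc k) (checkB L c acc sup ps false)
    knightAsks L c kc acc sup k []       balance budget = refl
    knightAsks L c kc acc sup k (p ∷ ps) balance budget
      rewrite qStep-knight {p} kc with answer p c in said
    ... | true  = knightRound L c kc (acc + 0) (sup + 1) (suc k) ps (support-balance balance)
                    (subst (_≤ L) (sym (cong (_+ spies ps) (+-identityʳ acc)))
                      (≤-trans (+-monoʳ-≤ acc (spies-∷ p ps)) budget))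
    ... | false = knightAccused L c kc acc sup k ps balance
                    (subst (_≤ L) (trans (cong (λ s → acc + s) (spies-∷-spy ps (accuser-of-knight kc said)))
                                         (sym (+-assoc acc 1 (spies ps)))) budget)

    -- Knight candidate just accused (by a spy); at height 1 this step is a
    -- visit and rejects him, otherwise the round goes on.
    knightAccused : ∀ L c → knight c ≡ true → ∀ acc sup k ps →
      acc + k ≡ sup → acc + 1 + spies ps ≤ L →
      Balanced (+ suc k) (consStep false (questions L c (acc + 1) (sup + 0) ps))
    knightAccused L c kc acc sup zero ps balance budget
      rewrite questions-reject {L} {c} {acc + 1} {sup + 0} {ps} (accuse-rejects balance) | kc
      = cong suc (roundStart (L ∸ (acc + 1)) ps (remaining-budget budget))
    knightAccused L c kc acc sup (suc k) ps balance budget =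
      knightRound L c kc (acc + 1) (sup + 0) k ps (accuse-balance balance) budget

    spyRound : ∀ L c → knight c ≡ false → ∀ acc sup j ps →
      acc + j ≡ sup → suc sup + spies ps ≤ L → Balanced -[1+ j ] (questions L c acc sup ps)
    spyRound L c kc acc sup j ps balance budget
      rewrite questions-continue {L} {c} {acc} {sup} {ps} (subst (acc ≤_) balance (m≤m+n acc j))
      with L ≤ᵇ sup in accepted
    ... | true  = ⊥-elim (n≮n sup (≤-trans (s≤s (m≤m+n sup (spies ps)))
                                   (≤-trans budget (≤ᵇ-sound accepted))))
    ... | false = spyAsks L c kc acc sup j ps balance budget

    spyAsks : ∀ L c → knight c ≡ false → ∀ acc sup j ps →
      acc + j ≡ sup → suc sup + spies ps ≤ L → Balanced -[1+ j ] (checkB L c acc sup ps false)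
    spyAsks L c kc acc sup j []       balance budget = refl
    spyAsks L c kc acc sup j (p ∷ ps) balance budget
      rewrite qStep-spy {p} kc with answer p c in said
    ... | true  = spyRound L c kc (acc + 0) (sup + 1) (suc j) ps (support-balance balance)
                    (subst (_≤ L) (trans (cong (λ s → suc sup + s) (spies-∷-spy ps (supporter-of-spy kc said)))
                                         (cong suc (sym (+-assoc sup 1 (spies ps))))) budget)
    ... | false = spyAccused L c kc acc sup j ps balance
                    (≤-trans (+-monoʳ-≤ (suc sup) (spies-∷ p ps)) budget)

    -- Spy candidate just accused; at height -1 this upward step rejects him
    -- without a visit, otherwise the round goes on.
    spyAccused : ∀ L c → knight c ≡ false → ∀ acc sup j ps →
      acc + j ≡ sup → suc sup + spies ps ≤ L →
      Balanced -[1+ j ] (consStep true (questions L c (acc + 1) (sup + 0) ps))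
    spyAccused L c kc acc sup zero ps balance budget
      rewrite questions-reject {L} {c} {acc + 1} {sup + 0} {ps} (accuse-rejects balance) | kc
      = roundStart (L ∸ (acc + 1)) ps (remaining-budget (subst (λ a → a + spies ps ≤ L) (accuse-tips balance) budget))
    spyAccused L c kc acc sup (suc j) ps balance budget =
      spyRound L c kc (acc + 1) (sup + 0) j ps (accuse-balance balance)
        (subst (λ s → suc s + spies ps ≤ L) (sym (+-identityʳ sup)) budget)

lemma1 : (n ℓ : ℕ) → 1 ≤ ℓ → 2 * ℓ < n →
    (knight : Fin n → Bool) → numSpies knight ≤ ℓ →
    (π : Permutation′ n) (ans : Fin n → Bool) →
    Σ (Fin (length (Step1.path knight ans ℓ (involvementOrder π))))
      (VisitsZeroFromAbove (Step1.path knight ans ℓ (involvementOrder π)))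
    ↔ Σ (Fin n) (λ p → (p ∈ Step1.rejected knight ans ℓ (involvementOrder π)) × (knight p ≡ true))
lemma1 n ℓ _ _ knight fewSpies π ans =
  begin
    Σ (Fin (length P)) (VisitsZeroFromAbove P)    ↔⟨ visitsZeroFromAbove↔ P ⟩
    Fin (visits (+ 0) P)                          ≡⟨ cong Fin (roundStart ℓ order budget) ⟩
    Fin (count knight R)                          ↔⟨ ↔-sym (members↔count knight R) ⟩
    Σ (Fin n) (λ p → (p ∈ R) × (knight p ≡ true)) ∎
  where
  open EquationalReasoning
  open Step1Analysis knight ans
  order : List (Fin n)
  order = involvementOrder π
  P : List Bool
  P = Step1.path knight ans ℓ order
  R : List (Fin n)
  R = Step1.rejected knight ans ℓ order
  budget : spies order ≤ ℓ
  budget = subst (_≤ ℓ) (sym (sum-reorder spy π)) fewSpies
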